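{- Let $\mathcal{L_N}$ be an elementary abelian $2$-group (additive, identity $\Omega'$) and $\mathcal{L_Q}$ a Steiner loop with identity $\bar\Omega$. Two factor systems $f_1,f_2\in\mathrm{Ext_S}(\mathcal{L_N},\mathcal{L_Q})$ are isomorphic if and only if $\alpha f_1\sim f_2\beta$ for some $\alpha\in\mathrm{Aut}(\mathcal{L_N})$ and $\beta\in\mathrm{Aut}(\mathcal{L_Q})$, where $(\alpha f_1)(P,Q)=\alpha(f_1(P,Q))$ and $(f_2\beta)(P,Q)=f_2(\beta(P),\beta(Q))$. Moreover, up to equivalence, the isomorphism between the corresponding loops has the form $(P,x)\mapsto(\beta(P),\alpha(x))$.
   Context: $\mathrm{Ext_S}(\mathcal{L_N},\mathcal{L_Q})$ is the set of functions $f:\mathcal{L_Q}\times\mathcal{L_Q}\to\mathcal{L_N}$ that are symmetric, satisfy $f(P,\bar\Omega)=\Omega'$ and $f(P,Q)=f(P,PQ)=f(Q,PQ)$ for all $P,Q$. Each such $f$ defines a Steiner loop $\mathcal{L}_f$ on $\mathcal{L_Q}\times\mathcal{L_N}$ with operation $(P,x)\circ(Q,y)=(PQ,x+y+f(P,Q))$. Factor systems $f_1,f_2$ are isomorphic if there is a loop isomorphism $\mathcal{L}_{f_1}\to\mathcal{L}_{f_2}$ mapping $\{(\bar\Omega,x):x\in\mathcal{L_N}\}$ onto itself. They are equivalent, written $f_1\sim f_2$, if there is a loop isomorphism $\Phi:\mathcal{L}_{f_1}\to\mathcal{L}_{f_2}$ with $\Phi(\bar\Omega,x)=(\bar\Omega,x)$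 and $\Phi(P,x)\in\{P\}\times\mathcal{L_N}$ for all $P,x$; equivalently $f_2=f_1+\delta^1\varphi$ where $(\delta^1\varphi)(P,Q)=\varphi(PQ)+\varphi(P)+\varphi(Q)$ for some $\varphi:\mathcal{L_Q}\to\mathcal{L_N}$ with $\varphi(\bar\Omega)=\Omega'$. A Steiner loop is the loop of a Steiner triple system with product "third point of the triple", $xx=$ identity. -}

module Defs where

open import Data.Product using (Σ; ∃; _×_; _,_; proj₁; proj₂)
open import Function using (id)
open import Function.Definitions using (Bijective)
open import Algebra.Structures using (IsAbelianGroup)
open import Relation.Binary.PropositionalEquality using (_≡_)

record ElemAb2Group : Set₁ where
  field
    Carrier : Set
    _+_     : Carrier → Carrier → Carrier
    0'      : Carrier
    isAbelianGroup : IsAbelianGroup _≡_ _+_ 0' id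
  infixl 6 _+_

-- A Steiner loop: a loop with identity e that is commutative and satisfies
-- x (x y) = y (hence x x = e); equivalently the loop of a Steiner triple
-- system with "third point" product.
record SteinerLoop : Set₁ where
  field
    Carrier : Set
    _·_     : Carrier → Carrier → Carrier
    e       : Carrier
    identityˡ : ∀ x → e · x ≡ x
    identityʳ : ∀ x → x · e ≡ x
    comm      : ∀ x y → x · y ≡ y · x
    inv       : ∀ x y → x · (x · y) ≡ y
  infixl 7 _·_

module _ (N : ElemAb2Group) (Q : SteinerLoop) where
  open ElemAb2Group N renaming (Carrier to NC)
  open SteinerLoop Q renaming (Carrier to QC)

  record IsFactorSystem (f : QC → QC → NC) : Set where
    field
      symm  : ∀ P R → f P R ≡ f R P
      unit  : ∀ P → f P e ≡ 0'
      tri₁  : ∀ P R → f P R ≡ f P (P · R)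
      tri₂  : ∀ P R → f P (P · R) ≡ f R (P · R)

  _∘[_]_ : QC × NC → (QC → QC → NC) → QC × NC → QC × NC
  (P , x) ∘[ f ] (R , y) = (P · R , x + y + f P R)

  δ¹ : (QC → NC) → QC → QC → NC
  δ¹ φ P R = φ (P · R) + φ P + φ R

  _∼_ : (QC → QC → NC) → (QC → QC → NC) → Set
  f₁ ∼ f₂ = Σ (QC → NC) λ φ → (φ e ≡ 0') × (∀ P R → f₂ P R ≡ f₁ P R + δ¹ φ P R)

  record IsNormalIso (f₁ f₂ : QC → QC → NC) (Φ : QC × NC → QC × NC) : Set where
    field
      bij   : Bijective _≡_ _≡_ Φ
      hom   : ∀ a b → Φ (a ∘[ f₁ ] b) ≡ Φ a ∘[ f₂ ] Φ b
      into  : ∀ x → proj₁ (Φ (e , x)) ≡ e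
      onto  : ∀ y → ∃ λ x → Φ (e , x) ≡ (e , y)

  Isomorphic : (QC → QC → NC) → (QC → QC → NC) → Set
  Isomorphic f₁ f₂ = ∃ λ Φ → IsNormalIso f₁ f₂ Φ

  record IsAutN (α : NC → NC) : Set where
    field
      bij : Bijective _≡_ _≡_ α
      hom : ∀ x y → α (x + y) ≡ α x + α y

  record IsAutQ (β : QC → QC) : Set where
    field
      bij : Bijective _≡_ _≡_ β
      hom : ∀ P R → β (P · R) ≡ β P · β R

  _⟨α⟩_ : (NC → NC) → (QC → QC → NC) → QC → QC → NC
  (α ⟨α⟩ f) P R = α (f P R)

  _⟨β⟩_ : (QC → QC → NC) → (QC → QC) → QC → QC → NC
  (f ⟨β⟩ β) P R = f (β P) (β R)

-- A normal isomorphism Φ : L_f₁ → L_f₂ restricts on the kernel {Ω̄} × L_N to an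
-- automorphism α, and since (P , x) = (P , Ω') ∘ (Ω̄ , x) it factors as
-- Φ (P , x) = (β P , α x + φ P) with (β P , φ P) := Φ (P , Ω').  Comparing
-- Φ ((P , Ω') ∘ (R , Ω')) with Φ (P , Ω') ∘ Φ (R , Ω') gives that β is a loop
-- homomorphism and f₂ (β P) (β R) = α (f₁ P R) + δ¹ φ P R; conversely these two
-- identities make (P , x) ↦ (β P , α x + φ P) a normal isomorphism, because in
-- characteristic 2 the cocycle identity can be moved across the equation.  Only the
-- normalisation f (P , Ω̄) = Ω' of the factor systems is used.
module Submission where

open import Algebra.Bundles using (Group; CommutativeMonoid)
open import Algebra.Structures using (IsAbelianGroup)
open import Data.Product using (Σ; _×_; _,_; proj₁; proj₂)
open import Function.Bundles using (_⇔_; mk⇔; Equivalence)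
open import Function.Definitions using (Bijective; Injective; StrictlySurjective)
open import Function.Consequences.Propositional using (strictlySurjective⇒surjective; surjective⇒strictlySurjective)
open import Relation.Binary.PropositionalEquality
open import Defs

module ElemAb2GroupProperties (N : ElemAb2Group) where
  open ElemAb2Group N
  open IsAbelianGroup isAbelianGroup using (isGroup; isCommutativeMonoid; inverseʳ; identityʳ; assoc)

  group : Group _ _
  group = record { isGroup = isGroup }

  commutativeMonoid : CommutativeMonoid _ _
  commutativeMonoid = record { isCommutativeMonoid = isCommutativeMonoid }

  open import Algebra.Properties.Group group public using (∙-cancelʳ; y≈x\\z; identityʳ-unique)
  open import Algebra.Solver.CommutativeMonoid commutativeMonoid using (solve; _⊜_; _⊕_)

  x+y+y≡x : ∀ x y → x + y + y ≡ x
  x+y+y≡x x y = trans (assoc x y y) (trans (cong (x +_) (inverseʳ y)) (identityʳ x))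

  a+b≡c+d+x⇔x≡a+[b+c+d] : ∀ a b c d x → (a + b ≡ c + d + x) ⇔ (x ≡ a + (b + c + d))
  a+b≡c+d+x⇔x≡a+[b+c+d] a b c d x = mk⇔
    (λ eq → trans (y≈x\\z (c + d) x (a + b) (sym eq)) (reorder a b c d))
    (λ eq → y≈x\\z (c + d) (a + b) x (trans (reorder a b c d) (sym eq)))
    where
    reorder : ∀ a b c d → (c + d) + (a + b) ≡ a + (b + c + d)
    reorder = solve 4 (λ a b c d → (c ⊕ d) ⊕ (a ⊕ b) ⊜ a ⊕ ((b ⊕ c) ⊕ d)) refl

module SteinerLoopProperties (Q : SteinerLoop) where
  open SteinerLoop Q

  x·x≡e : ∀ x → x · x ≡ e
  x·x≡e x = trans (cong (x ·_) (sym (identityʳ x))) (inv x e)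

  homomorphism⇒e↦e : ∀ {β : Carrier → Carrier} → (∀ P R → β (P · R) ≡ β P · β R) → β e ≡ e
  homomorphism⇒e↦e {β} β-hom = trans (cong β (sym (identityˡ e))) (trans (β-hom e e) (x·x≡e (β e)))

module ExtensionLoops (N : ElemAb2Group) (Q : SteinerLoop) where
  open ElemAb2Group N renaming (Carrier to NC)
  open SteinerLoop Q using (_·_; e) renaming (Carrier to QC; identityʳ to ·-identityʳ)
  open IsAbelianGroup isAbelianGroup using (identityˡ; identityʳ)
  open ElemAb2GroupProperties N

  _∘⟨_⟩_ : QC × NC → (QC → QC → NC) → QC × NC → QC × NC
  a ∘⟨ f ⟩ b = _∘[_]_ N Q a f b

  Normalised : (QC → QC → NC) → Set
  Normalised f = ∀ P → f P e ≡ 0'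

  ∘-kernelʳ : ∀ f → Normalised f → ∀ P x y → (P , x) ∘⟨ f ⟩ (e , y) ≡ (P , x + y)
  ∘-kernelʳ f f-normalised P x y =
    cong₂ _,_ (·-identityʳ P) (trans (cong (x + y +_) (f-normalised P)) (identityʳ (x + y)))

  section-∘-section : ∀ f P R → (P , 0') ∘⟨ f ⟩ (R , 0') ≡ (P · R , f P R)
  section-∘-section f P R = cong (P · R ,_) (trans (cong (_+ f P R) (identityʳ 0')) (identityˡ (f P R)))

  twist : (NC → NC) → (QC → QC) → (QC → NC) → QC × NC → QC × NC
  twist α β φ (P , x) = (β P , α x + φ P)

  twist-bijective : ∀ {α β} φ → Bijective _≡_ _≡_ α → Bijective _≡_ _≡_ β →
                    Bijective _≡_ _≡_ (twist α β φ)
  twist-bijective {α} {β} φ (α-injective , α-surjective) (β-injective , β-surjective) =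
    twist-injective , strictlySurjective⇒surjective twist-surjective
    where
    twist-injective : Injective _≡_ _≡_ (twist α β φ)
    twist-injective {P , x} {R , y} eq with β-injective (cong proj₁ eq)
    ... | refl = cong (P ,_) (α-injective (∙-cancelʳ (φ P) (α x) (α y) (cong proj₂ eq)))

    twist-surjective : StrictlySurjective _≡_ (twist α β φ)
    twist-surjective (S , z) =
      let (P , βP≡S) = surjective⇒strictlySurjective β-surjective S
          (x , αx≡z+φP) = surjective⇒strictlySurjective α-surjective (z + φ P)
      in (P , x) , cong₂ _,_ βP≡S (trans (cong (_+ φ P) αx≡z+φP) (x+y+y≡x z (φ P)))

module NormalIsomorphisms (N : ElemAb2Group) (Q : SteinerLoop)
  (f₁ f₂ : SteinerLoop.Carrier Q → SteinerLoop.Carrier Q → ElemAb2Group.Carrier N) where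
  open ElemAb2Group N renaming (Carrier to NC)
  open SteinerLoop Q using (_·_; e) renaming (Carrier to QC)
  open IsAbelianGroup isAbelianGroup using (identityˡ; identityʳ; comm; assoc)
  open ElemAb2GroupProperties N
  open SteinerLoopProperties Q
  open ExtensionLoops N Q
  open import Algebra.Solver.CommutativeMonoid commutativeMonoid using (solve; _⊜_; _⊕_)

  Cocycle : (NC → NC) → (QC → QC) → (QC → NC) → Set
  Cocycle α β φ = ∀ P R → f₂ (β P) (β R) ≡ α (f₁ P R) + δ¹ N Q φ P R

  IsTwist : (QC × NC → QC × NC) → Set
  IsTwist Φ = Σ (NC → NC) λ α → Σ (QC → QC) λ β → Σ (QC → NC) λ φ →
    IsAutN N Q α × IsAutQ N Q β × (φ e ≡ 0') × Cocycle α β φ × (∀ P x → Φ (P , x) ≡ twist α β φ (P , x))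

  twist-homomorphism : ∀ {α β φ} → (∀ x y → α (x + y) ≡ α x + α y) → (∀ P R → β (P · R) ≡ β P · β R) →
                       Cocycle α β φ → ∀ a b → twist α β φ (a ∘⟨ f₁ ⟩ b) ≡ twist α β φ a ∘⟨ f₂ ⟩ twist α β φ b
  twist-homomorphism {α} {β} {φ} α-hom β-hom cocycle (P , x) (R , y) = cong₂ _,_ (β-hom P R) (begin
      α (x + y + f₁ P R) + φ (P · R)              ≡⟨ cong (_+ φ (P · R)) (trans (α-hom _ _) (cong (_+ α (f₁ P R)) (α-hom x y))) ⟩
      α x + α y + α (f₁ P R) + φ (P · R)          ≡⟨ assoc (α x + α y) (α (f₁ P R)) (φ (P · R)) ⟩
      (α x + α y) + (α (f₁ P R) + φ (P · R))      ≡⟨ cong (α x + α y +_) (Equivalence.from (a+b≡c+d+x⇔x≡a+[b+c+d] _ _ _ _ _) (cocycle P R)) ⟩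
      (α x + α y) + (φ P + φ R + f₂ (β P) (β R))  ≡⟨ interchange (α x) (α y) (φ P) (φ R) (f₂ (β P) (β R)) ⟩
      (α x + φ P) + (α y + φ R) + f₂ (β P) (β R)  ∎)
    where
    open ≡-Reasoning
    interchange : ∀ a b c d z → (a + b) + (c + d + z) ≡ (a + c) + (b + d) + z
    interchange = solve 5 (λ a b c d z → (a ⊕ b) ⊕ ((c ⊕ d) ⊕ z) ⊜ ((a ⊕ c) ⊕ (b ⊕ d)) ⊕ z) refl

  twist-isNormalIso : ∀ {α β φ} → IsAutN N Q α → IsAutQ N Q β → φ e ≡ 0' → Cocycle α β φ →
                      IsNormalIso N Q f₁ f₂ (twist α β φ)
  twist-isNormalIso {α} {β} {φ} α-aut β-aut φe≡0 cocycle = record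
    { bij  = twist-bijective φ (IsAutN.bij α-aut) (IsAutQ.bij β-aut)
    ; hom  = twist-homomorphism (IsAutN.hom α-aut) (IsAutQ.hom β-aut) cocycle
    ; into = λ _ → βe≡e
    ; onto = λ y → let (x , αx≡y) = surjective⇒strictlySurjective (proj₂ (IsAutN.bij α-aut)) y
                   in x , cong₂ _,_ βe≡e (trans (cong₂ _+_ αx≡y φe≡0) (identityʳ y))
    }
    where
    βe≡e : β e ≡ e
    βe≡e = homomorphism⇒e↦e (IsAutQ.hom β-aut)

  module NormalIsoComponents (f₁-normalised : Normalised f₁) (f₂-normalised : Normalised f₂)
    {Φ : QC × NC → QC × NC} (iso : IsNormalIso N Q f₁ f₂ Φ) where
    open IsNormalIso iso

    α : NC → NC
    α x = proj₂ (Φ (e , x))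

    β : QC → QC
    β P = proj₁ (Φ (P , 0'))

    φ : QC → NC
    φ P = proj₂ (Φ (P , 0'))

    Φ-kernel : ∀ x → Φ (e , x) ≡ (e , α x)
    Φ-kernel x = cong (_, α x) (into x)

    α-hom : ∀ x y → α (x + y) ≡ α x + α y
    α-hom x y = cong proj₂ (begin
      (e , α (x + y))                  ≡⟨ Φ-kernel (x + y) ⟨
      Φ (e , x + y)                    ≡⟨ cong Φ (∘-kernelʳ f₁ f₁-normalised e x y) ⟨
      Φ ((e , x) ∘⟨ f₁ ⟩ (e , y))      ≡⟨ hom (e , x) (e , y) ⟩
      Φ (e , x) ∘⟨ f₂ ⟩ Φ (e , y)      ≡⟨ cong₂ _∘⟨ f₂ ⟩_ (Φ-kernel x) (Φ-kernel y) ⟩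
      (e , α x) ∘⟨ f₂ ⟩ (e , α y)      ≡⟨ ∘-kernelʳ f₂ f₂-normalised e (α x) (α y) ⟩
      (e , α x + α y)                  ∎)
      where open ≡-Reasoning

    Φ≗twist : ∀ P x → Φ (P , x) ≡ twist α β φ (P , x)
    Φ≗twist P x = begin
      Φ (P , x)                        ≡⟨ cong (λ y → Φ (P , y)) (identityˡ x) ⟨
      Φ (P , 0' + x)                   ≡⟨ cong Φ (∘-kernelʳ f₁ f₁-normalised P 0' x) ⟨
      Φ ((P , 0') ∘⟨ f₁ ⟩ (e , x))     ≡⟨ hom (P , 0') (e , x) ⟩
      Φ (P , 0') ∘⟨ f₂ ⟩ Φ (e , x)     ≡⟨ cong (Φ (P , 0') ∘⟨ f₂ ⟩_) (Φ-kernel x) ⟩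
      (β P , φ P) ∘⟨ f₂ ⟩ (e , α x)    ≡⟨ ∘-kernelʳ f₂ f₂-normalised (β P) (φ P) (α x) ⟩
      (β P , φ P + α x)                ≡⟨ cong (β P ,_) (comm (φ P) (α x)) ⟩
      (β P , α x + φ P)                ∎
      where open ≡-Reasoning

    Φ-on-sections : ∀ P R → (β (P · R) , α (f₁ P R) + φ (P · R)) ≡ (β P · β R , φ P + φ R + f₂ (β P) (β R))
    Φ-on-sections P R = begin
      (β (P · R) , α (f₁ P R) + φ (P · R))  ≡⟨ Φ≗twist (P · R) (f₁ P R) ⟨
      Φ (P · R , f₁ P R)                    ≡⟨ cong Φ (section-∘-section f₁ P R) ⟨
      Φ ((P , 0') ∘⟨ f₁ ⟩ (R , 0'))         ≡⟨ hom (P , 0') (R , 0') ⟩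
      Φ (P , 0') ∘⟨ f₂ ⟩ Φ (R , 0')         ∎
      where open ≡-Reasoning

    β-hom : ∀ P R → β (P · R) ≡ β P · β R
    β-hom P R = cong proj₁ (Φ-on-sections P R)

    cocycle : Cocycle α β φ
    cocycle P R = Equivalence.to (a+b≡c+d+x⇔x≡a+[b+c+d] _ _ _ _ _) (cong proj₂ (Φ-on-sections P R))

    φe≡0 : φ e ≡ 0'
    φe≡0 = identityʳ-unique (α 0') (φ e) (cong proj₂ (trans (sym (Φ≗twist e 0')) (Φ-kernel 0')))

    α-surjective : StrictlySurjective _≡_ α
    α-surjective y = let (x , Φex≡ey) = onto y in x , cong proj₂ Φex≡ey

    α-injective : Injective _≡_ _≡_ α
    α-injective {x} {y} αx≡αy =
      cong proj₂ (proj₁ bij (trans (Φ-kernel x) (trans (cong (e ,_) αx≡αy) (sym (Φ-kernel y)))))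

    α-isAut : IsAutN N Q α
    α-isAut = record { bij = α-injective , strictlySurjective⇒surjective α-surjective ; hom = α-hom }

    β-injective : Injective _≡_ _≡_ β
    β-injective {P} {R} βP≡βR = let (x , αx≡φP+φR) = α-surjective (φ P + φ R) in
      cong proj₁ (proj₁ bij (begin
        Φ (P , 0')              ≡⟨ cong₂ _,_ βP≡βR (sym (x+y+y≡x (φ P) (φ R))) ⟩
        (β R , φ P + φ R + φ R) ≡⟨ cong (λ z → (β R , z + φ R)) αx≡φP+φR ⟨
        (β R , α x + φ R)       ≡⟨ Φ≗twist R x ⟨
        Φ (R , x)               ∎))
      where open ≡-Reasoning

    β-surjective : StrictlySurjective _≡_ β
    β-surjective S = let ((P , x) , ΦPx≡S0) = surjective⇒strictlySurjective (proj₂ bij) (S , 0') in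
      P , trans (cong proj₁ (sym (Φ≗twist P x))) (cong proj₁ ΦPx≡S0)

    β-isAut : IsAutQ N Q β
    β-isAut = record { bij = β-injective , strictlySurjective⇒surjective β-surjective ; hom = β-hom }

    isTwist : IsTwist Φ
    isTwist = α , β , φ , α-isAut , β-isAut , φe≡0 , cocycle , Φ≗twist

  normalIso⇒isTwist : Normalised f₁ → Normalised f₂ → ∀ Φ → IsNormalIso N Q f₁ f₂ Φ → IsTwist Φ
  normalIso⇒isTwist f₁-normalised f₂-normalised Φ = NormalIsoComponents.isTwist f₁-normalised f₂-normalised

mainTheorem13 : (N : ElemAb2Group) (Q : SteinerLoop)
    (f₁ f₂ : SteinerLoop.Carrier Q → SteinerLoop.Carrier Q → ElemAb2Group.Carrier N) →
    IsFactorSystem N Q f₁ → IsFactorSystem N Q f₂ →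
    ((Isomorphic N Q f₁ f₂ →
        Σ (ElemAb2Group.Carrier N → ElemAb2Group.Carrier N) λ α →
        Σ (SteinerLoop.Carrier Q → SteinerLoop.Carrier Q) λ β →
          IsAutN N Q α × IsAutQ N Q β × _∼_ N Q (_⟨α⟩_ N Q α f₁) (_⟨β⟩_ N Q f₂ β))
     × ((Σ (ElemAb2Group.Carrier N → ElemAb2Group.Carrier N) λ α →
        Σ (SteinerLoop.Carrier Q → SteinerLoop.Carrier Q) λ β →
          IsAutN N Q α × IsAutQ N Q β × _∼_ N Q (_⟨α⟩_ N Q α f₁) (_⟨β⟩_ N Q f₂ β))
        → Isomorphic N Q f₁ f₂))
    × (∀ Φ → IsNormalIso N Q f₁ f₂ Φ →
        Σ (ElemAb2Group.Carrier N → ElemAb2Group.Carrier N) λ α →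
        Σ (SteinerLoop.Carrier Q → SteinerLoop.Carrier Q) λ β →
        Σ (SteinerLoop.Carrier Q → ElemAb2Group.Carrier N) λ φ →
          IsAutN N Q α × IsAutQ N Q β
          × (φ (SteinerLoop.e Q) ≡ ElemAb2Group.0' N)
          × (∀ P R → (_⟨β⟩_ N Q f₂ β) P R
                       ≡ ElemAb2Group._+_ N ((_⟨α⟩_ N Q α f₁) P R) (δ¹ N Q φ P R))
          × (∀ P x → Φ (P , x) ≡ (β P , ElemAb2Group._+_ N (α x) (φ P))))
mainTheorem13 N Q f₁ f₂ F₁ F₂ =
    ( (λ (Φ , iso) → let (α , β , φ , α-aut , β-aut , φe≡0 , cocycle , _) = isTwist Φ iso
                     in α , β , α-aut , β-aut , φ , φe≡0 , cocycle)
    , (λ (α , β , α-aut , β-aut , φ , φe≡0 , cocycle) →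
         twist α β φ , twist-isNormalIso α-aut β-aut φe≡0 cocycle) )
  , isTwist
  where
  open ExtensionLoops N Q using (twist)
  open NormalIsomorphisms N Q f₁ f₂ using (IsTwist; twist-isNormalIso; normalIso⇒isTwist)

  isTwist : ∀ Φ → IsNormalIso N Q f₁ f₂ Φ → IsTwist Φ
  isTwist = normalIso⇒isTwist (IsFactorSystem.unit F₁) (IsFactorSystem.unit F₂)
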